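{- Run $\textsc{IPR}$ with $\rho=4$ (and any $\alpha\in(0,1)$, $\epsilon\in(0,1)$). For each $i\ge0$ let $b^{(i)}_{\min}$ be the minimum of $p(B)$ over all $m$ bags in the collections $\mathcal{M}_1,\dots,\mathcal{M}_m$ after $i$ iterations of the while loop. Then $b^{(i+1)}_{\min}\ge b^{(i)}_{\min}$ for every iteration $i$.
   Context: Jobs with processing times $p_j\ge0$, $p(B)=\sum_{j\in B}p_j$, $m$ machines with predicted speeds $\hat s_i>0$; $opt(\mathbf{p},\hat{\mathbf{s}})$ is the minimum makespan of scheduling the jobs on machines with speeds $\hat{\mathbf{s}}$ (a job set of total processing time $P$ on machine $i$ takes time $P/\hat s_i$). Algorithm $\textsc{IPR}$ with inputs $\mathbf{p}$, $\hat{\mathbf{s}}$ ($\hat s_1\ge\cdots\ge\hat s_m$), $\alpha$, accuracy $\epsilon$, $\rho\ge1$: 1. Compute a partition $B_1,\dots,B_m$ with $p(B_1)\ge\cdots\ge p(B_m)$ and $\max_i p(B_i)/\hat s_i\le(1+\epsilon)\,opt(\mathbf{p},\hat{\mathbf{s}})$; set $\overline{\mathrm{OPT}}_C=\max_i p(B_i)/\hat s_i$ and $\mathcal{M}_i=\{B_i\}$. 2. While $\max\{p(B):B\in\cup_i\mathcal{M}_i,|B|\ge2\}>\rho\min\{p(B):B\in\cup_i\mathcal{M}_i\}$: let $(\mathcal{M}'_i)=\textsc{LPT-Rebalance}((\mathcal{M}_i))$; if $\max_i\sum_{B\in\mathcal{M}'_i}p(B)/\hat s_i>(1+\alpha)\overline{\mathrm{OPT}}_C$,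 return the bags in $\cup_i\mathcal{M}_i$; else set $\mathcal{M}_i\leftarrow\mathcal{M}'_i$ (this completes one iteration). 3. Return the bags in $\cup_i\mathcal{M}_i$. $\textsc{LPT-Rebalance}$: let $B_{\min}$ be a bag of minimum processing time; let $\mathcal{M}_{\max}$ be a collection containing a bag with at least two jobs of maximum processing time among such bags; move $B_{\min}$ into $\mathcal{M}_{\max}$; let $J$ be all jobs of $\mathcal{M}_{\max}$, $\ell=|\mathcal{M}_{\max}|$; redistribute $J$ into $\ell$ new bags by LPT (jobs in nonincreasing order of processing time, each to a currently least loaded bag), replacing the bags of $\mathcal{M}_{\max}$.
   Formalization: The processing times $p_j$, the predicted speeds $\hat s_i$ and the parameters $\alpha$ and $\epsilon$ are rational. -}

module Defs where

open import Data.Nat using (ℕ; zero; suc)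
import Data.Nat as ℕ
open import Data.Fin using (Fin; toℕ)
open import Data.Fin.Properties using () renaming (_≟_ to _≟ᶠ_)
open import Data.List using (List; []; _∷_; map; concat; concatMap; length; lookup; removeAt; allFin; filter; replicate; _[_]%=_; foldr)
open import Data.List.Membership.Propositional using (_∈_)
open import Data.List.Relation.Binary.Permutation.Propositional using (_↭_)
open import Data.List.Relation.Unary.Linked using (Linked)
open import Data.Rational using (ℚ; 0ℚ; 1ℚ; _+_; _*_; _≤_; _<_; _⊓_; _⊔_; 1/_; positive)
open import Data.Rational.Properties using (pos⇒nonZero)
open import Data.Product using (Σ; ∃; _×_; _,_)
open import Relation.Nullary.Negation using (¬_)
open import Relation.Binary.PropositionalEquality using (_≡_; refl)
open import Relation.Nullary using (yes; no)

sumℚ : List ℚ → ℚ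
sumℚ = foldr _+_ 0ℚ

-- minimum of a nonempty list (the empty list gets 0, never used)
minL : List ℚ → ℚ
minL []           = 0ℚ
minL (x ∷ [])     = x
minL (x ∷ y ∷ ys) = x ⊓ minL (y ∷ ys)

maxᶠ : ∀ {m} → (Fin (suc m) → ℚ) → ℚ
maxᶠ {zero}  f = f Fin.zero
  where import Data.Fin as Fin
maxᶠ {suc m} f = f Fin.zero ⊔ maxᶠ (λ i → f (Fin.suc i))
  where import Data.Fin as Fin

divPos : (x y : ℚ) → 0ℚ < y → ℚ
divPos x y y>0 = x * (1/ y) {{pos⇒nonZero y {{positive y>0}}}}

ρ₄ : ℚ
ρ₄ = 1ℚ + 1ℚ + 1ℚ + 1ℚ

module Scheduling {n m : ℕ}
                  (p : Fin n → ℚ)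
                  (ŝ : Fin (suc m) → ℚ)
                  (ŝ>0 : ∀ i → 0ℚ < ŝ i) where

  -- a bag is a set (list) of jobs; a state assigns to each machine a
  -- collection (list) of bags
  Bag : Set
  Bag = List (Fin n)

  State : Set
  State = Fin (suc m) → List Bag

  pB : Bag → ℚ
  pB B = sumℚ (map p B)

  time : ℚ → Fin (suc m) → ℚ
  time P i = divPos P (ŝ i) (ŝ>0 i)

  load : (Fin n → Fin (suc m)) → Fin (suc m) → ℚ
  load σ i = sumℚ (map p (filter (λ j → σ j ≟ᶠ i) (allFin n)))

  makespan : (Fin n → Fin (suc m)) → ℚ
  makespan σ = maxᶠ (λ i → time (load σ i) i)

  IsOpt : ℚ → Set
  IsOpt v = (∃ λ σ → makespan σ ≡ v) × (∀ σ → v ≤ makespan σ)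

  IsPartition : (Fin (suc m) → Bag) → Set
  IsPartition B = concat (map B (allFin (suc m))) ↭ allFin n

  InitialPartition : ℚ → (Fin (suc m) → Bag) → Set
  InitialPartition ε B =
      IsPartition B
    × (∀ i j → toℕ i ℕ.≤ toℕ j → pB (B j) ≤ pB (B i))
    × (∀ v → IsOpt v → maxᶠ (λ i → time (pB (B i)) i) ≤ (1ℚ + ε) * v)

  OPTC : (Fin (suc m) → Bag) → ℚ
  OPTC B = maxᶠ (λ i → time (pB (B i)) i)

  initState : (Fin (suc m) → Bag) → State
  initState B i = B i ∷ []

  bags : State → List Bag
  bags M = concatMap M (allFin (suc m))

  bmin : State → ℚ
  bmin M = minL (map pB (bags M))

  LoopCond : State → Set
  LoopCond M = ∃ λ B → B ∈ bags M × 2 ℕ.≤ length B × ρ₄ * bmin M < pB B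

  -- LPT: assign the jobs, in nonincreasing order of processing time, each
  -- to a currently least loaded bag (all tie-breakings allowed)

  data LPTRun : List Bag → List (Fin n) → List Bag → Set where
    done : ∀ {bs} → LPTRun bs [] bs
    step : ∀ {bs j js out} (k : Fin (length bs)) →
           (∀ k' → pB (lookup bs k) ≤ pB (lookup bs k')) →
           LPTRun (bs [ k ]%= (j ∷_)) js out →
           LPTRun bs (j ∷ js) out

  LPT : List (Fin n) → ℕ → List Bag → Set
  LPT J ℓ out = ∃ λ js → js ↭ J
                       × Linked (λ a b → p b ≤ p a) js
                       × LPTRun (replicate ℓ []) js out

  without : (M : State) (i₀ : Fin (suc m)) → Fin (length (M i₀)) → State
  without M i₀ k₀ i with i ≟ᶠ i₀
  ... | yes refl = removeAt (M i) k₀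
  ... | no  _    = M i

  record Rebalance (M M' : State) : Set where
    field
      i₀       : Fin (suc m)
      k₀       : Fin (length (M i₀))
      Bmin-min : pB (lookup (M i₀) k₀) ≡ bmin M
      i₁       : Fin (suc m)
      k₁       : Fin (length (M i₁))
      Bmax-2   : 2 ℕ.≤ length (lookup (M i₁) k₁)
      Bmax-max : ∀ B → B ∈ bags M → 2 ℕ.≤ length B →
                 pB B ≤ pB (lookup (M i₁) k₁)
      -- the LPT redistribution of the jobs of M_max ∪ {B_min}
      new      : List Bag
      new-LPT  : LPT (concat (lookup (M i₀) k₀ ∷ without M i₀ k₀ i₁))
                     (length (lookup (M i₀) k₀ ∷ without M i₀ k₀ i₁))
                     new
      at-max   : M' i₁ ≡ new
      elsewhere : ∀ i → ¬ (i ≡ i₁) → M' i ≡ without M i₀ k₀ i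

  -- One iteration of the while loop of IPR (ρ = 4) that does not return:
  -- the loop condition holds, M' = LPT-Rebalance(M), and the makespan test
  -- max_i Σ_{B ∈ M'_i} p(B)/ŝ_i ≤ (1+α)·OPT_C passes.

  colLoad : State → Fin (suc m) → ℚ
  colLoad M i = sumℚ (map pB (M i))

  Iteration : (α OPTC̄ : ℚ) → State → State → Set
  Iteration α OPTC̄ M M' =
      LoopCond M
    × Rebalance M M'
    × maxᶠ (λ i → time (colLoad M' i) i) ≤ (1ℚ + α) * OPTC̄

  data Reach (α : ℚ) (B : Fin (suc m) → Bag) : ℕ → State → Set where
    start : Reach α B 0 (initState B)
    next  : ∀ {k M M'} → Reach α B k M → Iteration α (OPTC B) M M' →
            Reach α B (suc k) M'

-- Let b be the least bag load before the iteration. Within a collection produced by LPT, a bag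
-- with at least two jobs weighs at most twice any other bag: its last job is its smallest, and
-- just before receiving it the bag was the lightest. So the loop condition (a bag heavier than
-- 4b) makes every bag of the rebalanced collection heavier than 2b, and redistributing these
-- bags together with the minimum bag by LPT cannot create a bag lighter than b.
module Submission where

open import Defs
open import Data.Nat using (ℕ; suc; zero; s≤s; z≤n)
import Data.Nat as ℕ
open import Data.Nat.Properties using (suc-injective)
open import Data.Fin using (Fin; toℕ)
import Data.Fin as Fin
open import Data.Fin.Properties using () renaming (_≟_ to _≟ᶠ_)
open import Data.List using (List; []; _∷_; map; concat; length; lookup; removeAt; allFin; replicate; _[_]%=_; _++_)
open import Data.List.Properties using (length-%=; length-replicate; ∷-injective)
open import Data.List.Membership.Propositional using (_∈_; lose)
open import Data.List.Membership.Propositional.Properties using (∈-map⁺; ∈-lookup; ∈-allFin; ∈-concatMap⁺; ∈-concatMap⁻)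
open import Data.List.Relation.Unary.Any using (here; there; index; satisfied)
open import Data.List.Relation.Unary.Any.Properties using (lookup-index; ¬Any[])
open import Data.List.Relation.Unary.All as All using (All; []; _∷_)
import Data.List.Relation.Unary.All.Properties as Allₚ
open import Data.List.Relation.Unary.AllPairs using (head)
open import Data.List.Relation.Unary.Linked using (Linked)
open import Data.List.Relation.Unary.Linked.Properties using (Linked⇒AllPairs)
open import Data.List.Relation.Binary.Subset.Propositional using (_⊆_)
open import Data.List.Relation.Binary.Permutation.Propositional using (_↭_; ↭-refl; ↭-trans; ↭⇒↭ₛ)
import Data.List.Relation.Binary.Permutation.Propositional.Properties as ↭
import Data.List.Relation.Binary.Permutation.Setoid.Properties as ↭ₛ
open import Data.Rational using (ℚ; 0ℚ; 1ℚ; _≤_; _<_; _+_; _*_; _⊓_)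
open import Data.Rational.Properties
open import Data.Product using (∃; _×_; _,_; proj₂)
open import Data.Sum using (_⊎_; inj₁; inj₂)
open import Data.Empty using (⊥; ⊥-elim)
open import Function using (id)
open import Relation.Nullary using (yes; no)
open import Relation.Binary.PropositionalEquality using (_≡_; refl; sym; trans; cong; subst; setoid; module ≡-Reasoning)
open import Algebra using (CommutativeMonoid)
open import Algebra.Properties.CommutativeSemigroup (CommutativeMonoid.commutativeSemigroup +-0-commutativeMonoid) using (x∙yz≈y∙xz)

sumMap : {A : Set} → (A → ℚ) → List A → ℚ
sumMap f xs = sumℚ (map f xs)

module _ {A : Set} (f : A → ℚ) where

  sumMap-++ : ∀ xs ys → sumMap f (xs ++ ys) ≡ sumMap f xs + sumMap f ys
  sumMap-++ []       ys = sym (+-identityˡ _)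
  sumMap-++ (x ∷ xs) ys = trans (cong (f x +_) (sumMap-++ xs ys)) (sym (+-assoc (f x) _ _))

  sumMap-concat : ∀ xss → sumMap f (concat xss) ≡ sumMap (sumMap f) xss
  sumMap-concat []         = refl
  sumMap-concat (xs ∷ xss) = trans (sumMap-++ xs (concat xss)) (cong (sumMap f xs +_) (sumMap-concat xss))

  sumMap-↭ : ∀ {xs ys} → xs ↭ ys → sumMap f xs ≡ sumMap f ys
  sumMap-↭ xs↭ys = ↭ₛ.foldr-commMonoid (setoid ℚ) +-0-isCommutativeMonoid (↭⇒↭ₛ (↭.map⁺ f xs↭ys))

  sumMap-nonneg : (∀ x → 0ℚ ≤ f x) → ∀ xs → 0ℚ ≤ sumMap f xs
  sumMap-nonneg f≥0 []       = ≤-refl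
  sumMap-nonneg f≥0 (x ∷ xs) =
    subst (_≤ f x + sumMap f xs) (+-identityˡ 0ℚ) (+-mono-≤ (f≥0 x) (sumMap-nonneg f≥0 xs))

  sumMap-≤-paired : ∀ {c} xs ys → length ys ≡ length xs →
                    All (λ y → f y ≤ c) ys → All (λ x → c ≤ f x) xs → sumMap f ys ≤ sumMap f xs
  sumMap-≤-paired []       []       _  _            _            = ≤-refl
  sumMap-≤-paired (x ∷ xs) (y ∷ ys) eq (y≤c ∷ ys≤c) (c≤x ∷ c≤xs) =
    +-mono-≤ (≤-trans y≤c c≤x) (sumMap-≤-paired xs ys (suc-injective eq) ys≤c c≤xs)

  sumMap-<-paired : ∀ {c a x₀} xs ys → length ys ≡ suc (length xs) →
                    All (λ y → f y ≤ c) ys → All (λ x → c ≤ f x) xs →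
                    a ∈ ys → f a < x₀ → sumMap f ys < x₀ + sumMap f xs
  sumMap-<-paired xs (y ∷ ys) eq (_ ∷ ys≤c) c≤xs (here refl) a<x₀ =
    +-mono-<-≤ a<x₀ (sumMap-≤-paired xs ys (suc-injective eq) ys≤c c≤xs)
  sumMap-<-paired [] (y ∷ []) _ _ _ (there ()) _
  sumMap-<-paired {x₀ = x₀} (x ∷ xs) (y ∷ ys) eq (y≤c ∷ ys≤c) (c≤x ∷ c≤xs) (there a∈ys) a<x₀ =
    subst (sumMap f (y ∷ ys) <_) (x∙yz≈y∙xz (f x) x₀ (sumMap f xs))
      (+-mono-≤-< (≤-trans y≤c c≤x) (sumMap-<-paired xs ys (suc-injective eq) ys≤c c≤xs a∈ys a<x₀))

sumMap-mono-≤ : ∀ {A : Set} {f g : A → ℚ} → (∀ x → f x ≤ g x) → ∀ xs → sumMap f xs ≤ sumMap g xs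
sumMap-mono-≤ f≤g []       = ≤-refl
sumMap-mono-≤ f≤g (x ∷ xs) = +-mono-≤ (f≤g x) (sumMap-mono-≤ f≤g xs)

minL-≤ : ∀ {x} xs → x ∈ xs → minL xs ≤ x
minL-≤ (x ∷ [])     (here refl) = ≤-refl
minL-≤ (x ∷ y ∷ ys) (here refl) = p⊓q≤p x _
minL-≤ (x ∷ y ∷ ys) (there x∈)  = ≤-trans (p⊓q≤q x _) (minL-≤ (y ∷ ys) x∈)

≤-minL : ∀ {c x} xs → x ∈ xs → All (c ≤_) xs → c ≤ minL xs
≤-minL (x ∷ [])     _ (c≤x ∷ [])  = c≤x
≤-minL (x ∷ y ∷ ys) _ (c≤x ∷ c≤ys) = ⊓-glb c≤x (≤-minL (y ∷ ys) (here refl) c≤ys)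

minL-nonneg : ∀ xs → All (0ℚ ≤_) xs → 0ℚ ≤ minL xs
minL-nonneg []       _    = ≤-refl
minL-nonneg (x ∷ xs) xs≥0 = ≤-minL (x ∷ xs) (here refl) xs≥0

p≤p+q : ∀ {p q} → 0ℚ ≤ q → p ≤ p + q
p≤p+q {p} {q} q≥0 = subst (_≤ p + q) (+-identityʳ p) (+-monoʳ-≤ p q≥0)

p≤q+p : ∀ {p q} → 0ℚ ≤ q → p ≤ q + p
p≤q+p {p} {q} q≥0 = subst (_≤ q + p) (+-identityˡ p) (+-monoˡ-≤ p q≥0)

p+p<q+q⇒p<q : ∀ {p q} → p + p < q + q → p < q
p+p<q+q⇒p<q p+p<q+q = ≰⇒> (λ q≤p → <-irrefl refl (<-≤-trans p+p<q+q (+-mono-≤ q≤p q≤p)))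

[p+q]⊓r≤p⊓r+q⊓r : ∀ {p q r} → 0ℚ ≤ p → 0ℚ ≤ q → 0ℚ ≤ r → (p + q) ⊓ r ≤ p ⊓ r + q ⊓ r
[p+q]⊓r≤p⊓r+q⊓r {p} {q} {r} p≥0 q≥0 r≥0 with ≤-total p r | ≤-total q r
... | inj₁ p≤r | inj₁ q≤r rewrite p≤q⇒p⊓q≡p p≤r | p≤q⇒p⊓q≡p q≤r = p⊓q≤p (p + q) r
... | inj₁ p≤r | inj₂ r≤q rewrite p≤q⇒p⊓q≡p p≤r | p≥q⇒p⊓q≡q r≤q =
  ≤-trans (p⊓q≤q (p + q) r) (p≤q+p p≥0)
... | inj₂ r≤p | _ rewrite p≥q⇒p⊓q≡q r≤p = ≤-trans (p⊓q≤q (p + q) r) (p≤p+q (⊓-glb q≥0 r≥0))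

ρ₄*p≡[p+p]+[p+p] : ∀ p → ρ₄ * p ≡ (p + p) + (p + p)
ρ₄*p≡[p+p]+[p+p] p = begin
  (((1ℚ + 1ℚ) + 1ℚ) + 1ℚ) * p            ≡⟨ *-distribʳ-+ p ((1ℚ + 1ℚ) + 1ℚ) 1ℚ ⟩
  ((1ℚ + 1ℚ) + 1ℚ) * p + 1ℚ * p          ≡⟨ cong (_+ 1ℚ * p) (*-distribʳ-+ p (1ℚ + 1ℚ) 1ℚ) ⟩
  ((1ℚ + 1ℚ) * p + 1ℚ * p) + 1ℚ * p      ≡⟨ cong (λ x → (x + 1ℚ * p) + 1ℚ * p) (*-distribʳ-+ p 1ℚ 1ℚ) ⟩
  ((1ℚ * p + 1ℚ * p) + 1ℚ * p) + 1ℚ * p  ≡⟨ cong (λ x → ((x + x) + x) + x) (*-identityˡ p) ⟩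
  ((p + p) + p) + p                      ≡⟨ +-assoc (p + p) p p ⟩
  (p + p) + (p + p)                      ∎
  where open ≡-Reasoning

∈-removeAt⁻ : ∀ {A : Set} {x : A} xs k → x ∈ removeAt xs k → x ∈ xs
∈-removeAt⁻ (y ∷ xs) Fin.zero    x∈         = there x∈
∈-removeAt⁻ (y ∷ xs) (Fin.suc k) (here eq)  = here eq
∈-removeAt⁻ (y ∷ xs) (Fin.suc k) (there x∈) = there (∈-removeAt⁻ xs k x∈)

∈-%=⁻ : ∀ {A : Set} {x : A} xs k (f : A → A) → x ∈ xs [ k ]%= f → x ≡ f (lookup xs k) ⊎ x ∈ xs
∈-%=⁻ (y ∷ xs) Fin.zero    f (here eq)  = inj₁ eq
∈-%=⁻ (y ∷ xs) Fin.zero    f (there x∈) = inj₂ (there x∈)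
∈-%=⁻ (y ∷ xs) (Fin.suc k) f (here eq)  = inj₂ (here eq)
∈-%=⁻ (y ∷ xs) (Fin.suc k) f (there x∈) with ∈-%=⁻ xs k f x∈
... | inj₁ eq  = inj₁ eq
... | inj₂ x∈xs = inj₂ (there x∈xs)

concat-%=-∷ : ∀ {A : Set} (xss : List (List A)) k x → concat (xss [ k ]%= (x ∷_)) ↭ x ∷ concat xss
concat-%=-∷ (xs ∷ xss) Fin.zero    x = ↭-refl
concat-%=-∷ (xs ∷ xss) (Fin.suc k) x =
  ↭-trans (↭.++⁺ˡ xs (concat-%=-∷ xss k x)) (↭.shift x xs (concat xss))

∈-of-length-suc : ∀ {A : Set} {k} (xs : List A) → length xs ≡ suc k → ∃ λ x → x ∈ xs
∈-of-length-suc (x ∷ _) _ = x , here refl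

concat-replicate-[] : ∀ {A : Set} ℓ → concat (replicate ℓ ([] {A = A})) ≡ []
concat-replicate-[] zero    = refl
concat-replicate-[] (suc ℓ) = concat-replicate-[] ℓ

module _ {n m : ℕ} (p : Fin n → ℚ) (ŝ : Fin (suc m) → ℚ) (ŝ>0 : ∀ i → 0ℚ < ŝ i)
         (p≥0 : ∀ j → 0ℚ ≤ p j) where

  open Scheduling p ŝ ŝ>0

  pB≥0 : ∀ B → 0ℚ ≤ pB B
  pB≥0 = sumMap-nonneg p p≥0

  Balanced : List Bag → Set
  Balanced bs = ∀ {C D} → C ∈ bs → D ∈ bs → 2 ℕ.≤ length C → pB C ≤ pB D + pB D

  Balanced-⊆ : ∀ {bs cs} → cs ⊆ bs → Balanced bs → Balanced cs
  Balanced-⊆ cs⊆bs bal C∈ D∈ = bal (cs⊆bs C∈) (cs⊆bs D∈)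

  Nonincreasing : List (Fin n) → Set
  Nonincreasing = Linked (λ i j → p j ≤ p i)

  Nonincreasing-head : ∀ {j js y} → Nonincreasing (j ∷ js) → y ∈ js → p y ≤ p j
  Nonincreasing-head js↓ = All.lookup (head (Linked⇒AllPairs (λ j≤i k≤j → ≤-trans k≤j j≤i) js↓))

  record LPTInvariant (bs : List Bag) (js : List (Fin n)) : Set where
    field
      pending-≤ : ∀ {C x y} → C ∈ bs → x ∈ C → y ∈ js → p y ≤ p x
      head-≤    : ∀ {c x r} → (c ∷ x ∷ r) ∈ bs → p c ≤ p x
      tail-≤    : ∀ {c r D} → (c ∷ r) ∈ bs → D ∈ bs → pB r ≤ pB D

  LPTInvariant⇒Balanced : ∀ {bs js} → LPTInvariant bs js → Balanced bs
  LPTInvariant⇒Balanced inv {_ ∷ []}    _  _  (s≤s ())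
  LPTInvariant⇒Balanced inv {c ∷ x ∷ r} C∈ D∈ _ = +-mono-≤ (≤-trans c≤x+r x+r≤D) x+r≤D
    where
      open LPTInvariant inv
      x+r≤D = tail-≤ C∈ D∈
      c≤x+r = ≤-trans (head-≤ C∈) (p≤p+q (pB≥0 r))

  LPTInvariant-replicate : ∀ ℓ js → LPTInvariant (replicate ℓ []) js
  LPTInvariant-replicate ℓ js = record
    { pending-≤ = λ C∈ x∈C _ → ⊥-elim (no-job C∈ x∈C)
    ; head-≤    = λ C∈ → ⊥-elim (no-cons C∈)
    ; tail-≤    = λ C∈ _ → ⊥-elim (no-cons C∈)
    }
    where
      empty : ∀ {C : Bag} → C ∈ replicate ℓ [] → C ≡ []
      empty = All.lookup (Allₚ.replicate⁺ {P = _≡ []} ℓ refl)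
      no-job : ∀ {C x} → C ∈ replicate ℓ [] → x ∈ C → ⊥
      no-job C∈ x∈C = ¬Any[] (subst (_ ∈_) (empty C∈) x∈C)
      no-cons : ∀ {c r} → (c ∷ r) ∈ replicate ℓ [] → ⊥
      no-cons C∈ with empty C∈
      ... | ()

  LPTInvariant-step : ∀ {bs j js} k → (∀ k′ → pB (lookup bs k) ≤ pB (lookup bs k′)) →
                      Nonincreasing (j ∷ js) → LPTInvariant bs (j ∷ js) →
                      LPTInvariant (bs [ k ]%= (j ∷_)) js
  LPTInvariant-step {bs} {j} {js} k k-least js↓ inv = record
    { pending-≤ = pending-≤′ ; head-≤ = head-≤′ ; tail-≤ = tail-≤′ }
    where
      open LPTInvariant inv
      least : ∀ {D} → D ∈ bs → pB (lookup bs k) ≤ pB D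
      least D∈ = subst (λ D → pB (lookup bs k) ≤ pB D) (sym (lookup-index D∈)) (k-least (index D∈))
      grown : ∀ {D′} → D′ ∈ bs [ k ]%= (j ∷_) → ∃ λ D → D ∈ bs × pB D ≤ pB D′
      grown {D′} D′∈ with ∈-%=⁻ bs k (j ∷_) D′∈
      ... | inj₁ refl = lookup bs k , ∈-lookup k , p≤q+p (p≥0 j)
      ... | inj₂ D′∈bs = D′ , D′∈bs , ≤-refl
      pending-≤′ : ∀ {C x y} → C ∈ bs [ k ]%= (j ∷_) → x ∈ C → y ∈ js → p y ≤ p x
      pending-≤′ C∈ x∈C y∈js with ∈-%=⁻ bs k (j ∷_) C∈ | x∈C
      ... | inj₁ refl | here refl  = Nonincreasing-head js↓ y∈js
      ... | inj₁ refl | there x∈C′ = pending-≤ (∈-lookup k) x∈C′ (there y∈js)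
      ... | inj₂ C∈bs | _          = pending-≤ C∈bs x∈C (there y∈js)
      head-≤′ : ∀ {c x r} → (c ∷ x ∷ r) ∈ bs [ k ]%= (j ∷_) → p c ≤ p x
      head-≤′ C∈ with ∈-%=⁻ bs k (j ∷_) C∈
      ... | inj₁ eq with refl , r≡C ← ∷-injective eq =
        pending-≤ (∈-lookup k) (subst (_ ∈_) r≡C (here refl)) (here refl)
      ... | inj₂ C∈bs = head-≤ C∈bs
      tail-≤′ : ∀ {c r D′} → (c ∷ r) ∈ bs [ k ]%= (j ∷_) → D′ ∈ bs [ k ]%= (j ∷_) → pB r ≤ pB D′
      tail-≤′ C∈ D′∈ with grown D′∈ | ∈-%=⁻ bs k (j ∷_) C∈
      ... | D , D∈ , D≤D′ | inj₁ refl = ≤-trans (least D∈) D≤D′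
      ... | D , D∈ , D≤D′ | inj₂ C∈bs = ≤-trans (tail-≤ C∈bs D∈) D≤D′

  lptRun-invariant : ∀ {bs js out} → LPTRun bs js out → Nonincreasing js →
                     LPTInvariant bs js → LPTInvariant out []
  lptRun-invariant done                 _   inv = inv
  lptRun-invariant (step k k-least run) js↓ inv =
    lptRun-invariant run (Linked.tail js↓) (LPTInvariant-step k k-least js↓ inv)
    where import Data.List.Relation.Unary.Linked as Linked

  lpt-balanced : ∀ {J ℓ out} → LPT J ℓ out → Balanced out
  lpt-balanced {ℓ = ℓ} (js , _ , js↓ , run) =
    LPTInvariant⇒Balanced (lptRun-invariant run js↓ (LPTInvariant-replicate ℓ js))

  lptRun-↭ : ∀ {bs js out} → LPTRun bs js out → concat out ↭ js ++ concat bs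
  lptRun-↭ done = ↭-refl
  lptRun-↭ {bs} {j ∷ js} (step k _ run) =
    ↭-trans (lptRun-↭ run) (↭-trans (↭.++⁺ˡ js (concat-%=-∷ bs k j)) (↭.shift j js (concat bs)))

  lpt-↭ : ∀ {J ℓ out} → LPT J ℓ out → concat out ↭ J
  lpt-↭ {ℓ = ℓ} (js , js↭J , _ , run) = ↭-trans (lptRun-↭ run)
    (subst (λ xs → js ++ xs ↭ _) (sym (concat-replicate-[] ℓ)) (↭-trans (↭.++-identityʳ js) js↭J))

  lptRun-length : ∀ {bs js out} → LPTRun bs js out → length out ≡ length bs
  lptRun-length done = refl
  lptRun-length {bs} {j ∷ _} (step k _ run) = trans (lptRun-length run) (length-%= bs k (j ∷_))

  lpt-length : ∀ {J ℓ out} → LPT J ℓ out → length out ≡ ℓ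
  lpt-length {ℓ = ℓ} (_ , _ , _ , run) = trans (lptRun-length run) (length-replicate ℓ)

  capped : ℚ → Bag → ℚ
  capped T = sumMap (λ j → p j ⊓ T)

  capped-≤ : ∀ T X → capped T X ≤ pB X
  capped-≤ T = sumMap-mono-≤ (λ j → p⊓q≤p (p j) T)

  ⊓-≤-capped : ∀ {T} → 0ℚ ≤ T → ∀ X → pB X ⊓ T ≤ capped T X
  ⊓-≤-capped {T} T≥0 []      = p⊓q≤p 0ℚ T
  ⊓-≤-capped {T} T≥0 (j ∷ X) =
    ≤-trans ([p+q]⊓r≤p⊓r+q⊓r (p≥0 j) (pB≥0 X) T≥0) (+-monoʳ-≤ (p j ⊓ T) (⊓-≤-capped T≥0 X))

  -- Cap every job at T = 2b; LPT conserves the total capped weight. The old bags weigh at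
  -- least b (B₀) and T (the others). A new bag A with pB A < b would bound every new bag by T
  -- (by balance when it has two jobs), with A even below b: the total would drop.
  lpt-bags-≥ : ∀ {b B₀ Bs out} → 0ℚ ≤ b → b ≤ pB B₀ → All (λ O → b + b ≤ pB O) Bs →
               LPT (concat (B₀ ∷ Bs)) (length (B₀ ∷ Bs)) out → All (λ A → b ≤ pB A) out
  lpt-bags-≥ {b} {B₀} {Bs} {out} b≥0 b≤B₀ heavy L =
    All.tabulate (λ A∈ → ≮⇒≥ (λ A<b → <-irrefl conserved (overfull A∈ A<b)))
    where
      T = b + b
      T≥0 = +-mono-≤ b≥0 b≥0
      conserved : sumMap (capped T) out ≡ capped T B₀ + sumMap (capped T) Bs
      conserved = begin
        sumMap (capped T) out           ≡⟨ sumMap-concat (λ j → p j ⊓ T) out ⟨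
        capped T (concat out)           ≡⟨ sumMap-↭ (λ j → p j ⊓ T) (lpt-↭ L) ⟩
        capped T (concat (B₀ ∷ Bs))     ≡⟨ sumMap-concat (λ j → p j ⊓ T) (B₀ ∷ Bs) ⟩
        sumMap (capped T) (B₀ ∷ Bs)     ∎
        where open ≡-Reasoning
      T≤Bs : All (λ O → T ≤ capped T O) Bs
      T≤Bs = All.map (λ {O} T≤O → ≤-trans (⊓-glb T≤O ≤-refl) (⊓-≤-capped T≥0 O)) heavy
      overfull : ∀ {A} → A ∈ out → pB A < b →
                 sumMap (capped T) out < capped T B₀ + sumMap (capped T) Bs
      overfull {A} A∈ A<b =
        sumMap-<-paired (capped T) Bs out (lpt-length L) (All.tabulate light) T≤Bs A∈ A<B₀
        where
          light : ∀ {X} → X ∈ out → capped T X ≤ T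
          light {[]}        _  = T≥0
          light {j ∷ []}    _  = subst (_≤ T) (sym (+-identityʳ (p j ⊓ T))) (p⊓q≤q (p j) T)
          light {j ∷ x ∷ r} X∈ = begin
            capped T (j ∷ x ∷ r) ≤⟨ capped-≤ T (j ∷ x ∷ r) ⟩
            pB (j ∷ x ∷ r)       ≤⟨ lpt-balanced L X∈ A∈ (s≤s (s≤s z≤n)) ⟩
            pB A + pB A          ≤⟨ +-mono-≤ (<⇒≤ A<b) (<⇒≤ A<b) ⟩
            T                    ∎
            where open ≤-Reasoning
          A<B₀ : capped T A < capped T B₀
          A<B₀ = begin-strict
            capped T A    ≤⟨ capped-≤ T A ⟩
            pB A          <⟨ A<b ⟩
            b             ≤⟨ ⊓-glb b≤B₀ (p≤p+q b≥0) ⟩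
            pB B₀ ⊓ T     ≤⟨ ⊓-≤-capped T≥0 B₀ ⟩
            capped T B₀   ∎
            where open ≤-Reasoning

  ∈-bags⁺ : ∀ {M X} i → X ∈ M i → X ∈ bags M
  ∈-bags⁺ {M} i X∈ = ∈-concatMap⁺ M (lose (∈-allFin i) X∈)

  ∈-bags⁻ : ∀ {M X} → X ∈ bags M → ∃ λ i → X ∈ M i
  ∈-bags⁻ {M} X∈ = satisfied (∈-concatMap⁻ M {xs = allFin (suc m)} X∈)

  bmin-≤ : ∀ {M X} → X ∈ bags M → bmin M ≤ pB X
  bmin-≤ {M} X∈ = minL-≤ (map pB (bags M)) (∈-map⁺ pB X∈)

  ≤-bmin : ∀ {M b X} → X ∈ bags M → (∀ {Y} → Y ∈ bags M → b ≤ pB Y) → b ≤ bmin M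
  ≤-bmin {M} X∈ b≤ = ≤-minL (map pB (bags M)) (∈-map⁺ pB X∈) (Allₚ.map⁺ (All.tabulate b≤))

  bmin-nonneg : ∀ M → 0ℚ ≤ bmin M
  bmin-nonneg M = minL-nonneg (map pB (bags M)) (Allₚ.map⁺ (All.tabulate (λ {X} _ → pB≥0 X)))

  without-⊆ : ∀ M i₀ k₀ i → without M i₀ k₀ i ⊆ M i
  without-⊆ M i₀ k₀ i with i ≟ᶠ i₀
  ... | yes refl = ∈-removeAt⁻ (M i) k₀
  ... | no  _    = id

  module _ {M M′ : State} (R : Rebalance M M′) where
    open Rebalance R

    rebalance-collection : ∀ i → M′ i ≡ new ⊎ M′ i ⊆ M i
    rebalance-collection i with i ≟ᶠ i₁
    ... | yes refl = inj₁ at-max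
    ... | no  i≢i₁ = inj₂ (λ X∈ → without-⊆ M i₀ k₀ i (subst (_ ∈_) (elsewhere i i≢i₁) X∈))

    rebalance-balanced : (∀ i → Balanced (M i)) → ∀ i → Balanced (M′ i)
    rebalance-balanced bal i with rebalance-collection i
    ... | inj₁ M′i≡new = subst Balanced (sym M′i≡new) (lpt-balanced new-LPT)
    ... | inj₂ M′i⊆Mi  = Balanced-⊆ M′i⊆Mi (bal i)

  reach-balanced : ∀ {α B k M} → Reach α B k M → ∀ i → Balanced (M i)
  reach-balanced {B = B} start i (here refl) (here refl) _ = p≤p+q (pB≥0 (B i))
  reach-balanced (next reach (_ , R , _)) = rebalance-balanced R (reach-balanced reach)

  bmin-nondecreasing : ∀ {α B k M M′} → Reach α B k M → Iteration α (OPTC B) M M′ → bmin M ≤ bmin M′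
  bmin-nondecreasing {M = M} {M′} reach ((Bₗ , Bₗ∈ , 2≤Bₗ , 4b<Bₗ) , R , _) =
    ≤-bmin (∈-bags⁺ i₁ (proj₂ some-bag)) bags′-≥
    where
      open Rebalance R
      b = bmin M
      heavy : All (λ O → b + b ≤ pB O) (without M i₀ k₀ i₁)
      heavy = All.tabulate λ {O} O∈ → <⇒≤ (p+p<q+q⇒p<q (begin-strict
        (b + b) + (b + b) ≡⟨ ρ₄*p≡[p+p]+[p+p] b ⟨
        ρ₄ * b            <⟨ 4b<Bₗ ⟩
        pB Bₗ             ≤⟨ Bmax-max Bₗ Bₗ∈ 2≤Bₗ ⟩
        pB Bmax           ≤⟨ reach-balanced reach i₁ (∈-lookup k₁) (without-⊆ M i₀ k₀ i₁ O∈) Bmax-2 ⟩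
        pB O + pB O       ∎))
        where open ≤-Reasoning
              Bmax = lookup (M i₁) k₁
      new-≥ : All (λ A → b ≤ pB A) new
      new-≥ = lpt-bags-≥ (bmin-nonneg M) (≤-reflexive (sym Bmin-min)) heavy new-LPT
      bags′-≥ : ∀ {X} → X ∈ bags M′ → b ≤ pB X
      bags′-≥ X∈ with ∈-bags⁻ X∈
      ... | i , X∈M′i with rebalance-collection R i
      ...   | inj₁ M′i≡new = All.lookup new-≥ (subst (_ ∈_) M′i≡new X∈M′i)
      ...   | inj₂ M′i⊆Mi  = bmin-≤ (∈-bags⁺ {M} i (M′i⊆Mi X∈M′i))
      some-bag : ∃ λ A → A ∈ M′ i₁
      some-bag = subst (λ bs → ∃ (_∈ bs)) (sym at-max) (∈-of-length-suc new (lpt-length new-LPT))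

lemma3 : ∀ {n m : ℕ} (p : Fin n → ℚ) (ŝ : Fin (suc m) → ℚ)
           (ŝ>0 : ∀ i → 0ℚ < ŝ i) (α ε : ℚ) (B : Fin (suc m) → List (Fin n))
           → (∀ j → 0ℚ ≤ p j)
           → (∀ i j → toℕ i Data.Nat.≤ toℕ j → ŝ j ≤ ŝ i)
           → 0ℚ < α → α < 1ℚ → 0ℚ < ε → ε < 1ℚ
           → Scheduling.InitialPartition p ŝ ŝ>0 ε B
           → ∀ (k : ℕ) (M M' : Scheduling.State p ŝ ŝ>0)
           → Scheduling.Reach p ŝ ŝ>0 α B k M
           → Scheduling.Iteration p ŝ ŝ>0 α (Scheduling.OPTC p ŝ ŝ>0 B) M M'
           → Scheduling.bmin p ŝ ŝ>0 M ≤ Scheduling.bmin p ŝ ŝ>0 M'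
lemma3 p ŝ ŝ>0 _ _ _ p≥0 _ _ _ _ _ _ _ _ _ = bmin-nondecreasing p ŝ ŝ>0 p≥0
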